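{- Consider any moment during the execution of DLM. Suppose the position $\pi^*(w)$ of an element $w$ on Off's list increases by exactly $1$, while DLM's permutation and budgets stay unchanged. Then $\Delta\Phi_w\le0$ and $\Delta\Psi_w\le0$.
   Context: Online Min-Sum Set Cover with requests of cardinality at most $r$, over a universe $\mathcal U$ of $n$ elements. Lists are permutations $\mathcal U\to\{1,\dots,n\}$. Algorithm DLM. Every element $z$ has a budget $b(z)$, initially $0$. The operation fetch$(z)$ moves $z$ to position 1 by $\pi(z)-1$ adjacent swaps, so every element that preceded $z$ moves back by one position, and then sets $b(z)\gets0$. On a request $R$ with $|R|=s$, let $x\in R$ be the element of $R$ with the smallest current position and let $\ell=\pi(x)$. DLM pays $\ell$ and executes fetch$(x)$. For every $y\in R\setminus\{x\}$ it sets $b(y)\gets b(y)+\ell/s$. Then, while some $z$ has $b(z)\ge\pi(z)$, it executes fetch$(z)$. Potentials. Let $\pi$ be DLM's current permutation and $\pi^*$ the current permutation of an arbitrary offline algorithm Off. Write $\pi(z)=2^{p(z)}+q(z)$ with $p(z)\ge0$ an integer and $0\le q(z)\le 2^{p(z)}-1$, and analogously $\pi^*(z)=2^{p^*(z)}+q^*(z)$. Set $\alpha=2$, $\gamma=5r$, $\beta=7.5r+5$ and $\kappa=\lceil\log_2(6\beta)\rceil$. Define - $\Phi_z=\alpha\, b(z)$ if $p(z)\le p^*(z)+\kappa$, and $\Phi_z=\beta\,\pi(z)-\gamma\, b(z)$ if $p(z)\ge p^*(z)+\kappa+1$; - $\Psi_z=0$ if $p(z)\le p^*(z)+\kappa-1$,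 and $\Psi_z=2\beta\, q(z)$ if $p(z)\ge p^*(z)+\kappa$. -}

module Defs where

open import Data.Nat as ℕ using (ℕ; zero; suc; _^_; _∸_; _<ᵇ_)
open import Data.Nat.Logarithm using (⌊log₂_⌋; ⌈log₂_⌉)
open import Data.Fin using (Fin)
open import Data.Fin.Properties using (_≟_)
open import Data.Integer using (+_)
open import Data.Rational using (ℚ; _/_; 0ℚ; _+_; _-_; _*_; _<_; _≤_)
open import Data.Bool using (Bool; true; false; if_then_else_; _∨_)
open import Data.List using (List; []; _∷_; filter; length; allFin)
open import Data.List.Relation.Unary.Unique.Propositional using (Unique)
open import Data.List.Relation.Binary.Permutation.Propositional using (_↭_)
open import Relation.Nullary using (does; ¬?)

⟦_⟧ : ℕ → ℚ
⟦ k ⟧ = + k / 1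

-- a list (permutation of the universe Fin n) is given by the order of the elements;
-- pos L z = 1-based position of z in L  (0 if z does not occur; never happens for permutations)
pos : ∀ {n} → List (Fin n) → Fin n → ℕ
pos [] z = 0
pos (y ∷ ys) z = if does (y ≟ z) then 1 else suc (pos ys z)

-- fetch: move z to the front; all elements that preceded z move back by one
-- (the net effect of the π(z)-1 adjacent swaps)
fetchList : ∀ {n} → Fin n → List (Fin n) → List (Fin n)
fetchList z L = z ∷ filter (λ y → ¬? (y ≟ z)) L

memᵇ : ∀ {n} → Fin n → List (Fin n) → Bool
memᵇ z [] = false
memᵇ z (y ∷ ys) = does (y ≟ z) ∨ memᵇ z ys

best : ∀ {n} → List (Fin n) → Fin n → List (Fin n) → Fin n
best L x [] = x
best L x (y ∷ ys) = if pos L y <ᵇ pos L x then best L y ys else best L x ys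

record State (n : ℕ) : Set where
  constructor ⟨_,_⟩
  field
    list   : List (Fin n)
    budget : Fin n → ℚ
open State public

fetchState : ∀ {n} → State n → Fin n → State n
fetchState ⟨ L , b ⟩ z =
  ⟨ fetchList z L , (λ y → if does (y ≟ z) then 0ℚ else b y) ⟩

-- ℓ / s as a rational (s ≥ 1 for nonempty requests)
divℕ : ℕ → ℕ → ℚ
divℕ l zero = 0ℚ
divℕ l (suc s) = + l / suc s

serveState : ∀ {n} → State n → Fin n → List (Fin n) → State n
serveState ⟨ L , b ⟩ x₀ xs =
  let R = x₀ ∷ xs
      x = best L x₀ xs
      ℓ = pos L x
      st = fetchState ⟨ L , b ⟩ x
  in ⟨ list st
     , (λ y → if does (y ≟ x) then 0ℚ
              else (if memᵇ y R then budget st y + divℕ ℓ (length R) else budget st y)) ⟩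

-- The states (moments) occurring during an execution of DLM on an arbitrary request
-- sequence with requests of cardinality at most r, from an arbitrary initial list.
-- A new request is served only when the while-loop has finished (no z with b(z) ≥ π(z));
-- the while-loop may fetch any z with b(z) ≥ π(z).
data Reachable {n : ℕ} (r : ℕ) : State n → Set where
  init  : (L : List (Fin n)) → L ↭ allFin n → Reachable r ⟨ L , (λ _ → 0ℚ) ⟩
  serve : ∀ {s} → Reachable r s →
          (∀ z → budget s z < ⟦ pos (list s) z ⟧) →
          (x₀ : Fin n) (xs : List (Fin n)) →
          Unique (x₀ ∷ xs) → length (x₀ ∷ xs) ℕ.≤ r →
          Reachable r (serveState s x₀ xs)
  loop  : ∀ {s} → Reachable r s → (z : Fin n) →
          ⟦ pos (list s) z ⟧ ≤ budget s z →
          Reachable r (fetchState s z)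

α : ℚ
α = + 2 / 1

γ : ℕ → ℚ
γ r = + (5 ℕ.* r) / 1

β : ℕ → ℚ
β r = + (15 ℕ.* r ℕ.+ 10) / 2

κ : ℕ → ℕ
κ r = ⌈log₂ (45 ℕ.* r ℕ.+ 30) ⌉       -- ⌈log₂ (6β)⌉, 6β = 45 r + 30

-- π = 2^p + q with 0 ≤ q ≤ 2^p - 1
pexp : ℕ → ℕ
pexp P = ⌊log₂ P ⌋

qrem : ℕ → ℕ
qrem P = P ∸ 2 ^ pexp P

-- Φ_z given P = π(z), P* = π*(z), budget b = b(z)
Φ : ℕ → ℕ → ℕ → ℚ → ℚ
Φ r P P* b =
  if does (pexp P ℕ.≤? pexp P* ℕ.+ κ r) then α * b
  else β r * ⟦ P ⟧ - γ r * b

-- Ψ_z given P = π(z), P* = π*(z)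
Ψ : ℕ → ℕ → ℕ → ℚ
Ψ r P P* =
  if does (suc (pexp P) ℕ.≤? pexp P* ℕ.+ κ r) then 0ℚ
  else ⟦ 2 ⟧ * β r * ⟦ qrem P ⟧

{-# OPTIONS --safe #-}
module Submission where

open import Defs
open import Data.Nat using (ℕ; suc)
open import Data.Fin using (Fin)
open import Data.List using (List; allFin)
open import Data.List.Relation.Binary.Permutation.Propositional using (_↭_)
open import Data.Rational using (_≤_)
open import Data.Product using (_×_)
open import Relation.Binary.PropositionalEquality using (_≡_)

open import Data.Bool using (true; false; if_then_else_)
open import Data.Empty using (⊥-elim)
open import Data.Fin.Properties using (_≟_)
open import Data.Integer as ℤ using (+_)
import Data.Integer.Properties as ℤ
open import Data.List using ([]; _∷_; filter; length)
open import Data.List.Properties using (filter-all)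
import Data.List.Relation.Unary.All as All
open import Data.List.Relation.Unary.All.Properties using (all-filter)
open import Data.List.Relation.Unary.AllPairs using (_∷_)
open import Data.List.Relation.Unary.Unique.Propositional using (Unique)
import Data.List.Relation.Unary.Unique.Propositional.Properties as Unique
open import Data.List.Relation.Binary.Permutation.Propositional using (↭-sym; ↭⇒↭ₛ)
import Data.List.Relation.Binary.Permutation.Setoid.Properties as PermutationSetoid
open import Data.Nat as ℕ using (z≤n; s≤s; _<ᵇ_)
import Data.Nat.Properties as ℕ
import Data.Nat.Coprimality as Coprime
open import Data.Nat.Logarithm using (⌊log₂⌋-mono-≤)
open import Data.Product using (_,_)
open import Function using (_$_)
open import Data.Rational
  using (ℚ; mkℚ; _/_; ½; 0ℚ; _+_; _-_; _*_; -_; _<_; *≤*; nonNegative)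
open import Data.Rational.Properties
  using ( normalize-coprime; normalize-nonNeg; /-cong; nonNegative⁻¹; nonNeg*nonNeg⇒nonNeg
        ; +-identityˡ; +-identityʳ; +-inverseʳ; *-distribˡ-+
        ; ≤-refl; ≤-trans; <⇒≤; +-mono-≤; +-monoˡ-≤; *-monoˡ-≤-nonNeg; module ≤-Reasoning)
open import Data.Rational.Solver using (module +-*-Solver)
open +-*-Solver using (solve; _:+_; _:*_; _:-_; _:=_; con)
open import Relation.Nullary using (Dec; does; yes; no; ¬?; ofʸ; ofⁿ)
open import Relation.Binary.PropositionalEquality
  using (refl; sym; trans; cong; cong₂; subst; subst₂; ≢-sym; _≢_; setoid)

-- Φ_w and Ψ_w see π*(w) only through the test  p(w) ≤ p*(w) + const,  and p* = ⌊log₂ π*⌋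
-- is monotone, so raising π*(w) can only move w from the far to the near branch.  For Ψ
-- this replaces 2βq ≥ 0 by 0.  For Φ it replaces βπ − γb by αb, which is no larger as
-- long as b ≤ (3/2)π, since (α + γ)·(3/2) = 7.5r + 3 ≤ β.  DLM maintains b ≤ (3/2)π:
-- a request is served only when every b < π, it credits ℓ/s ≤ π/2 (the credited y lies
-- in R together with the fetched x, so s ≥ 2, and ℓ ≤ π(y)), and fetches only move
-- other elements back.

module _ {n : ℕ} where

  pos-filter-≢ : ∀ {x y} (L : List (Fin n)) → Unique L → y ≢ x →
                 pos L y ℕ.≤ suc (pos (filter (λ z → ¬? (z ≟ x)) L) y)
  pos-filter-≢ [] _ _ = z≤n
  pos-filter-≢ {x} {y} (a ∷ L) (a∉L ∷ L!) y≢x with a ≟ x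
  ... | yes refl with a ≟ y
  ...   | yes a≡y = ⊥-elim (y≢x (sym a≡y))
  ...   | no _ = ℕ.≤-reflexive (cong (λ M → suc (pos M y))
                   (sym (filter-all (λ z → ¬? (z ≟ x)) (All.map ≢-sym a∉L))))
  pos-filter-≢ {x} {y} (a ∷ L) (_ ∷ L!) y≢x | no _ with a ≟ y
  ...   | yes _ = s≤s z≤n
  ...   | no _ = s≤s (pos-filter-≢ L L! y≢x)

  pos-fetchList-≢ : ∀ {x y} (L : List (Fin n)) → Unique L → y ≢ x →
                    pos L y ℕ.≤ pos (fetchList x L) y
  pos-fetchList-≢ {x} {y} L L! y≢x with x ≟ y
  ... | yes x≡y = ⊥-elim (y≢x (sym x≡y))
  ... | no _ = pos-filter-≢ L L! y≢x

  fetchList-unique : ∀ x {L : List (Fin n)} → Unique L → Unique (fetchList x L)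
  fetchList-unique x {L} L! =
    All.map ≢-sym (all-filter (λ z → ¬? (z ≟ x)) L) ∷ Unique.filter⁺ (λ z → ¬? (z ≟ x)) L!

  best-≤-head : ∀ (L : List (Fin n)) x ys → pos L (best L x ys) ℕ.≤ pos L x
  best-≤-head L x [] = ℕ.≤-refl
  best-≤-head L x (y ∷ ys) with pos L y <ᵇ pos L x | ℕ.<ᵇ-reflects-< (pos L y) (pos L x)
  ... | true  | ofʸ y<x = ℕ.≤-trans (best-≤-head L y ys) (ℕ.<⇒≤ y<x)
  ... | false | _       = best-≤-head L x ys

  best-≤-tail : ∀ (L : List (Fin n)) x ys z → memᵇ z ys ≡ true → pos L (best L x ys) ℕ.≤ pos L z
  best-≤-tail L x (y ∷ ys) z z∈y∷ys
    with pos L y <ᵇ pos L x | ℕ.<ᵇ-reflects-< (pos L y) (pos L x) | y ≟ z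
  ... | true  | _       | yes refl = best-≤-head L y ys
  ... | true  | _       | no _     = best-≤-tail L y ys z z∈y∷ys
  ... | false | ofⁿ y≮x | yes refl = ℕ.≤-trans (best-≤-head L x ys) (ℕ.≮⇒≥ y≮x)
  ... | false | _       | no _     = best-≤-tail L x ys z z∈y∷ys

  best-minimal : ∀ (L : List (Fin n)) x ys z → memᵇ z (x ∷ ys) ≡ true →
                 pos L (best L x ys) ℕ.≤ pos L z
  best-minimal L x ys z z∈R with x ≟ z
  ... | yes refl = best-≤-head L x ys
  ... | no _     = best-≤-tail L x ys z z∈R

  memᵇ-singleton : ∀ {x y : Fin n} → memᵇ y (x ∷ []) ≡ true → x ≡ y
  memᵇ-singleton {x} {y} y∈[x] with x ≟ y
  ... | yes x≡y = x≡y

⟦⟧-mkℚ : ∀ k → ⟦ k ⟧ ≡ mkℚ (+ k) 0 (Coprime.sym (Coprime.1-coprimeTo k))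
⟦⟧-mkℚ k = normalize-coprime _

⟦⟧-+ : ∀ a b → ⟦ a ℕ.+ b ⟧ ≡ ⟦ a ⟧ + ⟦ b ⟧
⟦⟧-+ a b = trans (/-cong (sym (cong₂ ℤ._+_ (ℤ.*-identityʳ (+ a)) (ℤ.*-identityʳ (+ b)))) refl)
                 (sym (cong₂ _+_ (⟦⟧-mkℚ a) (⟦⟧-mkℚ b)))

⟦⟧-* : ∀ a b → ⟦ a ℕ.* b ⟧ ≡ ⟦ a ⟧ * ⟦ b ⟧
⟦⟧-* a b = trans (/-cong {+ (a ℕ.* b)} {1} {+ a ℤ.* + b} (ℤ.pos-* a b) refl)
                 (sym (cong₂ _*_ (⟦⟧-mkℚ a) (⟦⟧-mkℚ b)))

⟦⟧-mono-≤ : ∀ {m n} → m ℕ.≤ n → ⟦ m ⟧ ≤ ⟦ n ⟧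
⟦⟧-mono-≤ {m} {n} m≤n = subst₂ _≤_ (sym (⟦⟧-mkℚ m)) (sym (⟦⟧-mkℚ n))
  (*≤* (subst₂ ℤ._≤_ (sym (ℤ.*-identityʳ (+ m))) (sym (ℤ.*-identityʳ (+ n))) (ℤ.+≤+ m≤n)))

⟦⟧-nonNeg : ∀ k → 0ℚ ≤ ⟦ k ⟧
⟦⟧-nonNeg k = ⟦⟧-mono-≤ {0} {k} z≤n

/-as-* : ∀ k d → + k / suc d ≡ ⟦ k ⟧ * (+ 1 / suc d)
/-as-* k d = trans (/-cong (sym (ℤ.*-identityʳ (+ k))) (sym (ℕ.*-identityˡ (suc d))))
                   (sym (cong₂ _*_ (⟦⟧-mkℚ k) (normalize-coprime (Coprime.1-coprimeTo (suc d)))))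

1/2+k≤½ : ∀ k → + 1 / suc (suc k) ≤ ½
1/2+k≤½ k = subst (_≤ ½) (sym (normalize-coprime (Coprime.1-coprimeTo (suc (suc k)))))
  (*≤* (subst₂ ℤ._≤_ (sym (ℤ.*-identityˡ (+ 2))) (sym (ℤ.*-identityˡ (+ suc (suc k))))
                     (ℤ.+≤+ (s≤s (s≤s z≤n)))))

affine/2 : ∀ a c r → + (a ℕ.* r ℕ.+ c) / 2 ≡ (⟦ a ⟧ * ⟦ r ⟧ + ⟦ c ⟧) * ½
affine/2 a c r = trans (/-as-* (a ℕ.* r ℕ.+ c) 1)
  (cong (_* ½) (trans (⟦⟧-+ (a ℕ.* r) c) (cong (_+ ⟦ c ⟧) (⟦⟧-* a r))))

0≤* : ∀ {p q} → 0ℚ ≤ p → 0ℚ ≤ q → 0ℚ ≤ p * q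
0≤* {p} {q} 0≤p 0≤q =
  nonNegative⁻¹ (p * q) {{nonNeg*nonNeg⇒nonNeg p {{nonNegative 0≤p}} q {{nonNegative 0≤q}}}}

0≤q-p : ∀ {p q} → p ≤ q → 0ℚ ≤ q - p
0≤q-p {p} {q} p≤q = subst (_≤ q - p) (+-inverseʳ p) (+-monoˡ-≤ (- p) p≤q)

p≤q+p : ∀ {q} p → 0ℚ ≤ q → p ≤ q + p
p≤q+p {q} p 0≤q = subst (_≤ q + p) (+-identityˡ p) (+-monoˡ-≤ p 0≤q)

2*ℓ/s≤ℓ : ∀ ℓ k → ⟦ 2 ⟧ * divℕ ℓ (suc (suc k)) ≤ ⟦ ℓ ⟧
2*ℓ/s≤ℓ ℓ k = begin
  ⟦ 2 ⟧ * (+ ℓ / suc (suc k))           ≡⟨ cong (⟦ 2 ⟧ *_) (/-as-* ℓ (suc k)) ⟩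
  ⟦ 2 ⟧ * (⟦ ℓ ⟧ * (+ 1 / suc (suc k))) ≤⟨ *-monoˡ-≤-nonNeg ⟦ 2 ⟧
                                             (*-monoˡ-≤-nonNeg ⟦ ℓ ⟧ {{normalize-nonNeg ℓ 1}} (1/2+k≤½ k)) ⟩
  ⟦ 2 ⟧ * (⟦ ℓ ⟧ * ½)                   ≡⟨ solve 1 (λ l → con ⟦ 2 ⟧ :* (l :* con ½) := l) refl ⟦ ℓ ⟧ ⟩
  ⟦ ℓ ⟧                                 ∎
  where open ≤-Reasoning

-- A record rather than a type alias, so that P is recovered by unification: ⟦_⟧ is not.
record BudgetBound (P : ℕ) (b : ℚ) : Set where
  constructor budgetBound
  field 2b≤3P : ⟦ 2 ⟧ * b ≤ ⟦ 3 ⟧ * ⟦ P ⟧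

budgetBound-mono : ∀ {P P′ b} → P ℕ.≤ P′ → BudgetBound P b → BudgetBound P′ b
budgetBound-mono P≤P′ (budgetBound 2b≤3P) =
  budgetBound (≤-trans 2b≤3P (*-monoˡ-≤-nonNeg ⟦ 3 ⟧ (⟦⟧-mono-≤ P≤P′)))

budgetBound-0 : ∀ P → BudgetBound P 0ℚ
budgetBound-0 P = budgetBound-mono z≤n (budgetBound ≤-refl)

budgetBound-+ : ∀ {P b e} → b ≤ ⟦ P ⟧ → ⟦ 2 ⟧ * e ≤ ⟦ P ⟧ → BudgetBound P (b + e)
budgetBound-+ {P} {b} {e} b≤P 2e≤P = budgetBound $ begin
  ⟦ 2 ⟧ * (b + e)         ≡⟨ *-distribˡ-+ ⟦ 2 ⟧ b e ⟩
  ⟦ 2 ⟧ * b + ⟦ 2 ⟧ * e   ≤⟨ +-mono-≤ (*-monoˡ-≤-nonNeg ⟦ 2 ⟧ b≤P) 2e≤P ⟩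
  ⟦ 2 ⟧ * ⟦ P ⟧ + ⟦ P ⟧   ≡⟨ solve 1 (λ x → con ⟦ 2 ⟧ :* x :+ x := con ⟦ 3 ⟧ :* x) refl ⟦ P ⟧ ⟩
  ⟦ 3 ⟧ * ⟦ P ⟧           ∎
  where open ≤-Reasoning

≤⇒budgetBound : ∀ {P b} → b ≤ ⟦ P ⟧ → BudgetBound P b
≤⇒budgetBound {P} {b} b≤P = subst (BudgetBound P) (+-identityʳ b) (budgetBound-+ b≤P (⟦⟧-nonNeg P))

budgetBound-credit : ∀ {P b ℓ} k → b ≤ ⟦ P ⟧ → ℓ ℕ.≤ P → BudgetBound P (b + divℕ ℓ (suc (suc k)))
budgetBound-credit {ℓ = ℓ} k b≤P ℓ≤P = budgetBound-+ b≤P (≤-trans (2*ℓ/s≤ℓ ℓ k) (⟦⟧-mono-≤ ℓ≤P))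

-- β P − γ b − α b = k (3P − 2b) + 2P  with  k = (α + γ) / 2.
budgetBound⇒αb≤βP-γb : ∀ r {P b} → BudgetBound P b → α * b ≤ β r * ⟦ P ⟧ - γ r * b
budgetBound⇒αb≤βP-γb r {P} {b} (budgetBound 2b≤3P) = begin
  α * b                                                    ≤⟨ p≤q+p (α * b) 0≤slack ⟩
  k * (⟦ 3 ⟧ * ⟦ P ⟧ - ⟦ 2 ⟧ * b) + ⟦ 2 ⟧ * ⟦ P ⟧ + α * b ≡⟨ expand ⟩
  β r * ⟦ P ⟧ - γ r * b                                    ∎
  where
  open ≤-Reasoning
  k = + (5 ℕ.* r ℕ.+ 2) / 2
  0≤slack : 0ℚ ≤ k * (⟦ 3 ⟧ * ⟦ P ⟧ - ⟦ 2 ⟧ * b) + ⟦ 2 ⟧ * ⟦ P ⟧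
  0≤slack = +-mono-≤ (0≤* (nonNegative⁻¹ k {{normalize-nonNeg (5 ℕ.* r ℕ.+ 2) 2}}) (0≤q-p 2b≤3P))
                     (0≤* (⟦⟧-nonNeg 2) (⟦⟧-nonNeg P))
  expand : k * (⟦ 3 ⟧ * ⟦ P ⟧ - ⟦ 2 ⟧ * b) + ⟦ 2 ⟧ * ⟦ P ⟧ + α * b ≡ β r * ⟦ P ⟧ - γ r * b
  expand rewrite affine/2 5 2 r | affine/2 15 10 r | ⟦⟧-* 5 r = solve 3 (λ R P b →
      (con ⟦ 5 ⟧ :* R :+ con ⟦ 2 ⟧) :* con ½ :* (con ⟦ 3 ⟧ :* P :- con ⟦ 2 ⟧ :* b)
        :+ con ⟦ 2 ⟧ :* P :+ con α :* b
      := (con ⟦ 15 ⟧ :* R :+ con ⟦ 10 ⟧) :* con ½ :* P :- con ⟦ 5 ⟧ :* R :* b)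
    refl ⟦ r ⟧ ⟦ P ⟧ b

2βq-nonNeg : ∀ r q → 0ℚ ≤ ⟦ 2 ⟧ * β r * ⟦ q ⟧
2βq-nonNeg r q = 0≤* (0≤* (⟦⟧-nonNeg 2) (nonNegative⁻¹ (β r) {{normalize-nonNeg (15 ℕ.* r ℕ.+ 10) 2}}))
                     (⟦⟧-nonNeg q)

BudgetBounded : ∀ {n} → State n → Set
BudgetBounded s = ∀ z → BudgetBound (pos (list s) z) (budget s z)

module _ {n : ℕ} where

  fetchState-budgetBounded : ∀ (s : State n) z → Unique (list s) → BudgetBounded s →
                             BudgetBounded (fetchState s z)
  fetchState-budgetBounded s z L! bounded y with y ≟ z
  ... | yes _   = budgetBound-0 _
  ... | no y≢z = budgetBound-mono (pos-fetchList-≢ (list s) L! y≢z) (bounded y)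

  serveState-budgetBounded : ∀ (s : State n) x₀ xs → Unique (list s) →
                             (∀ z → budget s z < ⟦ pos (list s) z ⟧) →
                             BudgetBounded (serveState s x₀ xs)
  serveState-budgetBounded s x₀ xs L! b<π y with y ≟ best (list s) x₀ xs
  ... | yes _ = budgetBound-0 _
  ... | no y≢x with memᵇ y (x₀ ∷ xs) in y∈R
  ...   | false = budgetBound-mono (pos-fetchList-≢ (list s) L! y≢x) (≤⇒budgetBound (<⇒≤ (b<π y)))
  ...   | true  = budgetBound-mono (pos-fetchList-≢ (list s) L! y≢x) (credited xs y∈R y≢x)
    where
    credited : ∀ xs → memᵇ y (x₀ ∷ xs) ≡ true → y ≢ best (list s) x₀ xs →
               BudgetBound (pos (list s) y)
                           (budget s y + divℕ (pos (list s) (best (list s) x₀ xs)) (length (x₀ ∷ xs)))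
    credited []        y∈R y≢x = ⊥-elim (y≢x (sym (memᵇ-singleton y∈R)))
    credited (x₁ ∷ xs) y∈R _   =
      budgetBound-credit (length xs) (<⇒≤ (b<π y)) (best-minimal (list s) x₀ (x₁ ∷ xs) y y∈R)

  reachable-unique : ∀ {r} {s : State n} → Reachable r s → Unique (list s)
  reachable-unique (init L L↭) = PermutationSetoid.Unique-resp-↭ (setoid (Fin n))
                                   (↭⇒↭ₛ (↭-sym L↭)) (Unique.allFin⁺ n)
  reachable-unique (serve rs _ _ _ _ _) = fetchList-unique _ (reachable-unique rs)
  reachable-unique (loop rs z _)        = fetchList-unique z (reachable-unique rs)

  reachable-budgetBounded : ∀ {r} {s : State n} → Reachable r s → BudgetBounded s
  reachable-budgetBounded (init L _) z = budgetBound-0 (pos L z)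
  reachable-budgetBounded (serve {s} rs b<π x₀ xs _ _) =
    serveState-budgetBounded s x₀ xs (reachable-unique rs) b<π
  reachable-budgetBounded (loop {s} rs z _) =
    fetchState-budgetBounded s z (reachable-unique rs) (reachable-budgetBounded rs)

if-does-antitone : ∀ {A B : Set} (a? : Dec A) (b? : Dec B) → (A → B) → ∀ {x y : ℚ} → y ≤ x →
                   (if does b? then y else x) ≤ (if does a? then y else x)
if-does-antitone (yes _) (yes _) _   _   = ≤-refl
if-does-antitone (no _)  (no _)  _   _   = ≤-refl
if-does-antitone (no _)  (yes _) _   y≤x = y≤x
if-does-antitone (yes a) (no ¬b) a⇒b _   = ⊥-elim (¬b (a⇒b a))

≤-pexp-+-mono : ∀ {a P* P*′} k → P* ℕ.≤ P*′ → a ℕ.≤ pexp P* ℕ.+ k → a ℕ.≤ pexp P*′ ℕ.+ k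
≤-pexp-+-mono k P*≤P*′ a≤ = ℕ.≤-trans a≤ (ℕ.+-monoˡ-≤ k (⌊log₂⌋-mono-≤ P*≤P*′))

Φ-antitone : ∀ r {P P* P*′ b} → BudgetBound P b → P* ℕ.≤ P*′ → Φ r P P*′ b ≤ Φ r P P* b
Φ-antitone r {P} {P*} {P*′} bound P*≤P*′ =
  if-does-antitone (pexp P ℕ.≤? pexp P* ℕ.+ κ r) (pexp P ℕ.≤? pexp P*′ ℕ.+ κ r)
    (≤-pexp-+-mono (κ r) P*≤P*′) (budgetBound⇒αb≤βP-γb r bound)

Ψ-antitone : ∀ r P {P* P*′} → P* ℕ.≤ P*′ → Ψ r P P*′ ≤ Ψ r P P*
Ψ-antitone r P {P*} {P*′} P*≤P*′ =
  if-does-antitone (suc (pexp P) ℕ.≤? pexp P* ℕ.+ κ r) (suc (pexp P) ℕ.≤? pexp P*′ ℕ.+ κ r)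
    (≤-pexp-+-mono (κ r) P*≤P*′) (2βq-nonNeg r (qrem P))

lemma6 : ∀ {n} (r : ℕ) (s : State n) → Reachable r s →
         (w : Fin n) (Off Off′ : List (Fin n)) →
         Off ↭ allFin n → Off′ ↭ allFin n →
         pos Off′ w ≡ suc (pos Off w) →
         (Φ r (pos (list s) w) (pos Off′ w) (budget s w) ≤ Φ r (pos (list s) w) (pos Off w) (budget s w))
         × (Ψ r (pos (list s) w) (pos Off′ w) ≤ Ψ r (pos (list s) w) (pos Off w))
lemma6 r s rs w Off Off′ _ _ π*′≡1+π* =
  Φ-antitone r (reachable-budgetBounded rs w) π*≤π*′ , Ψ-antitone r (pos (list s) w) π*≤π*′
  where
  π*≤π*′ : pos Off w ℕ.≤ pos Off′ w
  π*≤π*′ = subst (pos Off w ℕ.≤_) (sym π*′≡1+π*) (ℕ.n≤1+n (pos Off w))
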